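{- Every interval is either inner-facing, outer-facing, or asymmetric. Moreover, for every positive integer $n$, up to isomorphism of SN-graphs there is a unique interval of each of these three types with length $n$.
   Context: Consider the seating process at a circular table with $n$ seats and one napkin between each pair of consecutive seats, in which diners are seated one at a time and each seated diner takes one available adjacent napkin if there is one. An SN-graph is a graph whose vertices are each marked as a "seat" or a "napkin"; two SN-graphs are isomorphic if there is a graph isomorphism between them mapping seat vertices to seat vertices and napkin vertices to napkin vertices. The table graph of a state of the table is the SN-graph whose vertices are the empty seats and the still-available napkins, with an edge between an empty seat and an available napkin whenever they are adjacent at the table (so initially the table graph of an $n$-seat table is the cycle $C_{2n}$). An interval is an acyclic SN-graph with a positive number of seat vertices that is isomorphic to some connected component of the table graph of some state arising in this process. The length of an interval is its number of seat vertices. An interval of length $n$ is inner-facing if it has $n-1$ napkin vertices, outer-facing if it has $n+1$ napkin vertices, and asymmetric if it has $n$ napkin vertices. -}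

module Defs where

open import Data.Nat using (ℕ; zero; suc; _+_; _<_)
open import Data.Fin using (Fin; zero; suc; toℕ; fromℕ; inject₁; _≟_)
open import Data.Bool using (Bool; true; false; if_then_else_; not)
open import Data.Sum using (_⊎_; inj₁; inj₂)
open import Data.Product using (Σ; ∃; _×_; _,_)
open import Data.Empty using (⊥)
open import Relation.Nullary using (¬_; does)
open import Relation.Binary.PropositionalEquality using (_≡_)
open import Function using (_∘_)
open import Function.Bundles using (_↔_; _⇔_; Inverse)
open import Function.Definitions using (Injective)

-- SN-graphs: finite simple graphs with vertices Fin size, each vertex
-- marked as a seat (isSeat = true) or a napkin (isSeat = false).

record SNGraph : Set where
  field
    size   : ℕ
    isSeat : Fin size → Bool
    adj    : Fin size → Fin size → Bool
    adj-sym    : ∀ i j → adj i j ≡ adj j i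
    adj-irrefl : ∀ i → adj i i ≡ false
open SNGraph public

record SNIso (G H : SNGraph) : Set where
  field
    bij      : Fin (size G) ↔ Fin (size H)
    pres-seat : ∀ i → isSeat H (Inverse.to bij i) ≡ isSeat G i
    pres-adj  : ∀ i j → adj H (Inverse.to bij i) (Inverse.to bij j) ≡ adj G i j

countTrue : ∀ {m} → (Fin m → Bool) → ℕ
countTrue {zero}  f = 0
countTrue {suc m} f = (if f zero then 1 else 0) + countTrue (f ∘ suc)

numSeats : SNGraph → ℕ
numSeats G = countTrue (isSeat G)

numNapkins : SNGraph → ℕ
numNapkins G = countTrue (not ∘ isSeat G)

len : SNGraph → ℕ
len = numSeats

data Reach (G : SNGraph) (i : Fin (size G)) : Fin (size G) → Set where
  here : Reach G i i
  step : ∀ {j k} → Reach G i j → adj G j k ≡ true → Reach G i k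

Connected : SNGraph → Set
Connected G = ∀ i j → Reach G i j

HasCycle : SNGraph → Set
HasCycle G = Σ ℕ λ k → Σ (Fin (suc (suc (suc k))) → Fin (size G)) λ c →
  Injective _≡_ _≡_ c ×
  (∀ (i : Fin (suc (suc k))) → adj G (c (inject₁ i)) (c (suc i)) ≡ true) ×
  (adj G (c (fromℕ (suc (suc k)))) (c zero) ≡ true)

Acyclic : SNGraph → Set
Acyclic G = ¬ HasCycle G

-- The table with n seats (Fin n) and n napkins (Fin n).  Napkin k lies
-- between seat k and seat k+1 (mod n), so seat s is adjacent to napkin s
-- and napkin s-1 (mod n).

NapAdj : (n : ℕ) → Fin n → Fin n → Set
NapAdj n s k = (toℕ k ≡ toℕ s) ⊎ (suc (toℕ k) ≡ toℕ s) ⊎ ((toℕ s ≡ 0) × (suc (toℕ k) ≡ n))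

record TableState (n : ℕ) : Set where
  constructor ⟨_,_⟩
  field
    occupied : Fin n → Bool
    taken    : Fin n → Bool
open TableState public

setTrue : ∀ {n} → (Fin n → Bool) → Fin n → (Fin n → Bool)
setTrue f s j = if does (j ≟ s) then true else f j

data Reachable (n : ℕ) : TableState n → Set where
  start : Reachable n ⟨ (λ _ → false) , (λ _ → false) ⟩
  sit-take : ∀ {st} s k → Reachable n st → occupied st s ≡ false →
    NapAdj n s k → taken st k ≡ false →
    Reachable n ⟨ setTrue (occupied st) s , setTrue (taken st) k ⟩
  sit-none : ∀ {st} s → Reachable n st → occupied st s ≡ false →
    (∀ k → NapAdj n s k → taken st k ≡ true) →
    Reachable n ⟨ setTrue (occupied st) s , taken st ⟩

TV : ℕ → Set
TV n = Fin n ⊎ Fin n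

tvIsSeat : ∀ {n} → TV n → Bool
tvIsSeat (inj₁ _) = true
tvIsSeat (inj₂ _) = false

-- vertex of the table graph of state st: empty seat or available napkin
Present : ∀ {n} → TableState n → TV n → Set
Present st (inj₁ s) = occupied st s ≡ false
Present st (inj₂ k) = taken st k ≡ false

TAdj : (n : ℕ) → TV n → TV n → Set
TAdj n (inj₁ s) (inj₂ k) = NapAdj n s k
TAdj n (inj₂ k) (inj₁ s) = NapAdj n s k
TAdj n (inj₁ _) (inj₁ _) = ⊥
TAdj n (inj₂ _) (inj₂ _) = ⊥

-- f is an isomorphism from G onto a connected component of the table
-- graph of st (an induced, connected, maximal subgraph).
record ComponentEmbedding (G : SNGraph) (n : ℕ) (st : TableState n)
                          (f : Fin (size G) → TV n) : Set where
  field
    inj       : Injective _≡_ _≡_ f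
    present   : ∀ i → Present st (f i)
    seat      : ∀ i → isSeat G i ≡ tvIsSeat (f i)
    adjacency : ∀ i j → (adj G i j ≡ true) ⇔ TAdj n (f i) (f j)
    connected : Connected G
    closed    : ∀ i v → Present st v → TAdj n (f i) v → ∃ λ j → f j ≡ v

IsComponentOfReachableState : SNGraph → Set
IsComponentOfReachableState G =
  Σ ℕ λ n → Σ (TableState (suc n)) λ st → Reachable (suc n) st ×
    Σ (Fin (size G) → TV (suc n)) λ f → ComponentEmbedding G (suc n) st f

Interval : SNGraph → Set
Interval G = Acyclic G × (0 < numSeats G) × IsComponentOfReachableState G

InnerFacing OuterFacing Asymmetric : SNGraph → Set
InnerFacing G = numNapkins G + 1 ≡ numSeats G
OuterFacing G = numNapkins G ≡ numSeats G + 1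
Asymmetric  G = numNapkins G ≡ numSeats G

data IntervalType : Set where
  inner outer asym : IntervalType

HasType : IntervalType → SNGraph → Set
HasType inner = InnerFacing
HasType outer = OuterFacing
HasType asym  = Asymmetric

-- Lay the vertices of the table around a circle, seat s at position 2s and napkin k at 2k+1, so that
-- adjacency in the table graph is adjacency on the circle.  An acyclic component leaves some position
-- uncovered (otherwise it is the whole cycle, or the table has a single seat), and cutting the circle
-- there turns its positions into consecutive integers: every interval is a path along which seats and
-- napkins alternate.  Such a path has one seat more than napkins, one fewer, or as many; its numbers of
-- seats and napkins determine its length, and also its first vertex unless the length is even, in
-- which case reversing the path swaps the two choices.  For existence, diners at seats 0, n+1 and n+2
-- of a table with n+3 seats leave an interval of length n of each type, depending on which napkins
-- they take.

module Submission where

open import Defs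
open import Data.Bool using (Bool; true; false; not; _∨_; if_then_else_)
open import Data.Bool.Properties using (not-involutive; ∨-comm; ¬-not; not-¬; T-≡; T-∨; ⇔→≡)
open import Data.Empty using (⊥-elim)
open import Data.Fin using (Fin; zero; suc; toℕ; fromℕ; fromℕ<; inject₁; opposite)
open import Data.Fin.Properties
  using (toℕ-injective; toℕ<n; toℕ-fromℕ<; toℕ-inject₁; toℕ-fromℕ; opposite-prop; opposite-involutive)
import Data.Fin.Properties as Fin
open import Data.Fin.Induction using (<-weakInduction)
open import Data.Fin.Relation.Unary.Top using (view; ‵fromℕ; ‵inj₁)
open import Data.List using (List; []; _∷_; allFin; foldl)
open import Data.List.Relation.Unary.All as All using (All; []; _∷_)
open import Data.List.Relation.Unary.Any using (here; there)
open import Data.List.Membership.Propositional using (_∈_)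
open import Data.List.Membership.Propositional.Properties using (∈-allFin)
open import Data.List.Extrema.Nat using (argmax; argmin; f[xs]≤f[argmax]; f[argmin]≤f[xs])
open import Data.Nat using (ℕ; zero; suc; _+_; _∸_; _<_; _≤_; _≡ᵇ_; ⌊_/2⌋; z≤n; s≤s; s≤s⁻¹; _<?_)
open import Data.Nat.Properties
open import Data.Product using (∃; ∃₂; _×_; _,_; proj₁; proj₂)
open import Data.Sum using (_⊎_; inj₁; inj₂; swap)
import Data.Sum as Sum
open import Function using (_∘_; id; case_of_)
open import Function.Definitions using (Injective)
open import Function.Bundles using (_↔_; _⇔_; mk⇔; Inverse; Equivalence; mk↔ₛ′)
open import Function.Properties.Inverse using (↔-refl; ↔-sym; ↔-trans)
import Function.Properties.Equivalence as ⇔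
open import Relation.Nullary using (¬_; Dec; yes; no)
open import Relation.Binary.PropositionalEquality
open import Algebra.Properties.CommutativeMonoid.Sum +-0-commutativeMonoid using (sum; sum-permute)

open ≡-Reasoning

alternate : Bool → ℕ → Bool
alternate b zero    = b
alternate b (suc t) = alternate (not b) t

alternate-+ : ∀ b a t → alternate b (a + t) ≡ alternate (alternate b a) t
alternate-+ b zero    t = refl
alternate-+ b (suc a) t = alternate-+ (not b) a t

not-alternate : ∀ b t → not (alternate b t) ≡ alternate (not b) t
not-alternate b zero    = refl
not-alternate b (suc t) = not-alternate (not b) t

alternate-double : ∀ b k → alternate b (k + k) ≡ b
alternate-double b zero    = refl
alternate-double b (suc k) = begin
  alternate (not b) (k + suc k)   ≡⟨ cong (alternate (not b)) (+-suc k k) ⟩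
  alternate (not (not b)) (k + k) ≡⟨ alternate-double (not (not b)) k ⟩
  not (not b)                     ≡⟨ not-involutive b ⟩
  b                               ∎

alternate-twice : ∀ b t → alternate (alternate b t) t ≡ b
alternate-twice b t = trans (sym (alternate-+ b t t)) (alternate-double b t)

Neighbours : ℕ → ℕ → Set
Neighbours a c = suc a ≡ c ⊎ suc c ≡ a

neighbours? : ℕ → ℕ → Bool
neighbours? a c = (suc a ≡ᵇ c) ∨ (suc c ≡ᵇ a)

Neighbours⇔neighbours? : ∀ a c → Neighbours a c ⇔ (neighbours? a c ≡ true)
Neighbours⇔neighbours? a c = mk⇔
  (Equivalence.to T-≡ ∘ Equivalence.from T-∨ ∘ Sum.map (≡⇒≡ᵇ (suc a) c) (≡⇒≡ᵇ (suc c) a))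
  (Sum.map (≡ᵇ⇒≡ (suc a) c) (≡ᵇ⇒≡ (suc c) a) ∘ Equivalence.to T-∨ ∘ Equivalence.from T-≡)

neighbours?-irrefl : ∀ a → neighbours? a a ≡ false
neighbours?-irrefl a = ¬-not λ e → Sum.[ 1+n≢n , 1+n≢n ] (Equivalence.from (Neighbours⇔neighbours? a a) e)

path : Bool → ℕ → SNGraph
path b L = record
  { size       = L
  ; isSeat     = λ t → alternate b (toℕ t)
  ; adj        = λ t u → neighbours? (toℕ t) (toℕ u)
  ; adj-sym    = λ t u → ∨-comm (suc (toℕ t) ≡ᵇ toℕ u) _
  ; adj-irrefl = λ t → neighbours?-irrefl (toℕ t)
  }

bit : Bool → ℕ
bit b = if b then 1 else 0

countTrue-cong : ∀ {m} {f g : Fin m → Bool} → (∀ i → f i ≡ g i) → countTrue f ≡ countTrue g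
countTrue-cong {zero}  e = refl
countTrue-cong {suc m} e = cong₂ _+_ (cong bit (e zero)) (countTrue-cong (e ∘ suc))

countTrue≡sum : ∀ {m} (f : Fin m → Bool) → countTrue f ≡ sum (bit ∘ f)
countTrue≡sum {zero}  f = refl
countTrue≡sum {suc m} f = cong (bit (f zero) +_) (countTrue≡sum (f ∘ suc))

countTrue-permute : ∀ {m k} (f : Fin k → Bool) (π : Fin m ↔ Fin k) →
                    countTrue (f ∘ Inverse.to π) ≡ countTrue f
countTrue-permute f π = begin
  countTrue (f ∘ Inverse.to π) ≡⟨ countTrue≡sum (f ∘ Inverse.to π) ⟩
  sum (bit ∘ f ∘ Inverse.to π) ≡⟨ sum-permute (bit ∘ f) π ⟨
  sum (bit ∘ f)                ≡⟨ countTrue≡sum f ⟨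
  countTrue f                  ∎

alternations : Bool → ℕ → ℕ
alternations b L = countTrue {L} (alternate b ∘ toℕ)

numNapkins-path : ∀ b L → numNapkins (path b L) ≡ alternations (not b) L
numNapkins-path b L = countTrue-cong {L} (not-alternate b ∘ toℕ)

alternations-sum : ∀ b L → alternations b L + alternations (not b) L ≡ L
alternations-sum true  zero    = refl
alternations-sum false zero    = refl
alternations-sum true  (suc L) = cong suc (alternations-sum false L)
alternations-sum false (suc L) = trans (+-suc (alternations true L) _) (cong suc (alternations-sum true L))

alternations-balanced : ∀ L → alternations true L ≡ alternations false L
                            ⊎ alternations true L ≡ suc (alternations false L)
alternations-balanced zero    = inj₁ refl
alternations-balanced (suc L) with alternations-balanced L
... | inj₁ e = inj₂ (cong suc (sym e))
... | inj₂ e = inj₁ (sym e)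

alternations-double : ∀ b k → alternations b (k + k) ≡ k
alternations-double b     zero    = refl
alternations-double true  (suc k) = begin
  suc (alternations false (k + suc k)) ≡⟨ cong (suc ∘ alternations false) (+-suc k k) ⟩
  suc (alternations true (k + k))      ≡⟨ cong suc (alternations-double true k) ⟩
  suc k                                ∎
alternations-double false (suc k) = begin
  alternations true (k + suc k)        ≡⟨ cong (alternations true) (+-suc k k) ⟩
  suc (alternations false (k + k))     ≡⟨ cong suc (alternations-double false k) ⟩
  suc k                                ∎

infix 4 _≅_
_≅_ : SNGraph → SNGraph → Set
_≅_ = SNIso

≅-refl : ∀ {G} → G ≅ G
≅-refl = record { bij = ↔-refl ; pres-seat = λ _ → refl ; pres-adj = λ _ _ → refl }

≅-sym : ∀ {G H} → G ≅ H → H ≅ G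
≅-sym {G} {H} φ = record
  { bij       = ↔-sym π
  ; pres-seat = λ i → trans (sym (SNIso.pres-seat φ (from i))) (cong (isSeat H) (Inverse.strictlyInverseˡ π i))
  ; pres-adj  = λ i j → trans (sym (SNIso.pres-adj φ (from i) (from j)))
                              (cong₂ (adj H) (Inverse.strictlyInverseˡ π i) (Inverse.strictlyInverseˡ π j))
  }
  where
  π : Fin (size G) ↔ Fin (size H)
  π = SNIso.bij φ
  from : Fin (size H) → Fin (size G)
  from = Inverse.from π

≅-trans : ∀ {G H K} → G ≅ H → H ≅ K → G ≅ K
≅-trans φ ψ = record
  { bij       = ↔-trans (SNIso.bij φ) (SNIso.bij ψ)
  ; pres-seat = λ i → trans (SNIso.pres-seat ψ _) (SNIso.pres-seat φ i)
  ; pres-adj  = λ i j → trans (SNIso.pres-adj ψ _ _) (SNIso.pres-adj φ i j)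
  }

≅-numSeats : ∀ {G H} → G ≅ H → numSeats G ≡ numSeats H
≅-numSeats {G} {H} φ =
  trans (sym (countTrue-cong (SNIso.pres-seat φ))) (countTrue-permute (isSeat H) (SNIso.bij φ))

≅-numNapkins : ∀ {G H} → G ≅ H → numNapkins G ≡ numNapkins H
≅-numNapkins {G} {H} φ =
  trans (sym (countTrue-cong (cong not ∘ SNIso.pres-seat φ))) (countTrue-permute (not ∘ isSeat H) (SNIso.bij φ))

≅-path : ∀ {G b L} (φ : Fin (size G) ↔ Fin L) →
         (∀ i → alternate b (toℕ (Inverse.to φ i)) ≡ isSeat G i) →
         (∀ i j → Neighbours (toℕ (Inverse.to φ i)) (toℕ (Inverse.to φ j)) ⇔ (adj G i j ≡ true)) →
         G ≅ path b L
≅-path φ seat adjacent = record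
  { bij       = φ
  ; pres-seat = seat
  ; pres-adj  = λ i j → ⇔→≡ (⇔.trans (⇔.sym (Neighbours⇔neighbours? _ _)) (adjacent i j))
  }

Neighbours-mirror : ∀ {x y t u} → x + t ≡ y + u → Neighbours t u → Neighbours y x
Neighbours-mirror {x} {y} {t}     e (inj₁ refl) = inj₁ (+-cancelʳ-≡ t (suc y) x (trans (sym (+-suc y t)) (sym e)))
Neighbours-mirror {x} {y} {u = u} e (inj₂ refl) = inj₂ (+-cancelʳ-≡ u (suc x) y (trans (sym (+-suc x u)) e))

alternate-mirror : ∀ b x t k → x + suc t ≡ k + k → alternate (not b) x ≡ alternate b t
alternate-mirror b x t k e = begin
  alternate (not b) x                  ≡⟨ alternate-twice (alternate (not b) x) t ⟨
  alternate (alternate c t) t          ≡⟨ cong (λ c → alternate c t) c-t≡b ⟩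
  alternate b t                        ∎
  where
  c : Bool
  c = alternate (not b) x
  c-t≡b : alternate c t ≡ b
  c-t≡b = begin
    alternate c t                      ≡⟨ cong (λ c → alternate c t) (not-alternate b x) ⟨
    alternate (alternate b x) (suc t)  ≡⟨ alternate-+ b x (suc t) ⟨
    alternate b (x + suc t)            ≡⟨ cong (alternate b) e ⟩
    alternate b (k + k)                ≡⟨ alternate-double b k ⟩
    b                                  ∎

opposite-+ : ∀ {L} (t : Fin L) → toℕ (opposite t) + suc (toℕ t) ≡ L
opposite-+ t = trans (cong (_+ suc (toℕ t)) (opposite-prop t)) (m∸n+n≡m (toℕ<n t))

path-reverse : ∀ b k → path b (k + k) ≅ path (not b) (k + k)
path-reverse b k = ≅-path (mk↔ₛ′ opposite opposite opposite-involutive opposite-involutive)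
  (λ t → alternate-mirror b (toℕ (opposite t)) (toℕ t) k (opposite-+ t))
  (λ t u → ⇔.trans (mk⇔ (mirror-back t u) (mirror t u)) (Neighbours⇔neighbours? _ _))
  where
  opposite-sums : ∀ t u → toℕ (opposite t) + suc (toℕ t) ≡ toℕ (opposite u) + suc (toℕ u)
  opposite-sums t u = trans (opposite-+ t) (sym (opposite-+ u))
  mirror : ∀ t u → Neighbours (toℕ t) (toℕ u) → Neighbours (toℕ (opposite t)) (toℕ (opposite u))
  mirror t u = swap ∘ Neighbours-mirror (opposite-sums t u) ∘ Sum.map (cong suc) (cong suc)
  mirror-back : ∀ t u → Neighbours (toℕ (opposite t)) (toℕ (opposite u)) → Neighbours (toℕ t) (toℕ u)
  mirror-back t u = swap ∘ Sum.map suc-injective suc-injective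
    ∘ Neighbours-mirror (trans (+-comm (suc (toℕ t)) _) (trans (opposite-sums t u) (+-comm _ (suc (toℕ u)))))

argmax-Fin : ∀ {m} (g : Fin m → ℕ) → Fin m → ∃ λ i → ∀ j → g j ≤ g i
argmax-Fin g i₀ = argmax g i₀ (allFin _) , λ j → All.lookup (f[xs]≤f[argmax] {f = g} i₀ (allFin _)) (∈-allFin j)

argmin-Fin : ∀ {m} (g : Fin m → ℕ) → Fin m → ∃ λ i → ∀ j → g i ≤ g j
argmin-Fin g i₀ = argmin g i₀ (allFin _) , λ j → All.lookup (f[argmin]≤f[xs] {f = g} i₀ (allFin _)) (∈-allFin j)

Neighbours-below : ∀ {a c} → Neighbours a c → c ≤ a → suc c ≡ a
Neighbours-below (inj₁ refl) c≤a = ⊥-elim (1+n≰n c≤a)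
Neighbours-below (inj₂ e)    _   = e

inject₁²≢suc² : ∀ {n} (x : Fin n) → inject₁ (inject₁ x) ≢ suc (suc x)
inject₁²≢suc² zero    ()
inject₁²≢suc² (suc x) e = inject₁²≢suc² x (Fin.suc-injective e)

cycle-neighbours : ∀ G {k} (c : Fin (suc (suc (suc k))) → Fin (size G)) →
                   (∀ (i : Fin (suc (suc k))) → adj G (c (inject₁ i)) (c (suc i)) ≡ true) →
                   adj G (c (fromℕ (suc (suc k)))) (c zero) ≡ true →
                   ∀ i → ∃₂ λ j l → j ≢ l × adj G (c i) (c j) ≡ true × adj G (c i) (c l) ≡ true
cycle-neighbours G c consecutive closing zero =
  suc zero , fromℕ _ , (λ ()) , consecutive zero , trans (adj-sym G _ _) closing
cycle-neighbours G c consecutive closing (suc i) with view i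
... | ‵fromℕ = inject₁ (fromℕ _) , zero , (λ ()) , trans (adj-sym G _ _) (consecutive (fromℕ _)) , closing
... | ‵inj₁ {i = j} _ = inject₁ (inject₁ j) , suc (suc j) , inject₁²≢suc² j ,
                        trans (adj-sym G _ _) (consecutive (inject₁ j)) , consecutive (suc j)

-- At a vertex of maximal label, both cycle neighbours would have to carry the label one below.
labelled-acyclic : ∀ G (r : Fin (size G) → ℕ) → Injective _≡_ _≡_ r →
                   (∀ i j → adj G i j ≡ true → Neighbours (r i) (r j)) → Acyclic G
labelled-acyclic G r r-inj neighbours (k , c , c-inj , consecutive , closing) =
  let top , maximal = argmax-Fin (r ∘ c) zero
      j , l , j≢l , top-j , top-l = cycle-neighbours G c consecutive closing top
  in j≢l (c-inj (r-inj (suc-injective (begin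
       suc (r (c j))   ≡⟨ Neighbours-below (neighbours _ _ top-j) (maximal j) ⟩
       r (c top)       ≡⟨ Neighbours-below (neighbours _ _ top-l) (maximal l) ⟨
       suc (r (c l))   ∎))))

path-acyclic : ∀ b L → Acyclic (path b L)
path-acyclic b L = labelled-acyclic (path b L) toℕ toℕ-injective
  (λ t u → Equivalence.from (Neighbours⇔neighbours? (toℕ t) (toℕ u)))

Reach-trans : ∀ {G i j k} → Reach G i j → Reach G j k → Reach G i k
Reach-trans r here         = r
Reach-trans r (step r′ e)  = step (Reach-trans r r′) e

Reach-sym : ∀ {G i j} → Reach G i j → Reach G j i
Reach-sym here = here
Reach-sym {G} (step {j} {k} r e) = Reach-trans (step here (trans (adj-sym G k j) e)) (Reach-sym r)

path-connected : ∀ b L → Connected (path b L)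
path-connected b zero    ()
path-connected b (suc L) t u = Reach-trans (Reach-sym (from-zero t)) (from-zero u)
  where
  from-zero : ∀ t → Reach (path b (suc L)) zero t
  from-zero = <-weakInduction (Reach (path b (suc L)) zero) here
    (λ i r → step r (Equivalence.to (Neighbours⇔neighbours? _ _) (inj₁ (cong suc (toℕ-inject₁ i)))))

Neighbours-+ˡ : ∀ d {a c} → Neighbours a c ⇔ Neighbours (d + a) (d + c)
Neighbours-+ˡ d {a} {c} = mk⇔
  (Sum.map (λ e → trans (sym (+-suc d a)) (cong (d +_) e)) (λ e → trans (sym (+-suc d c)) (cong (d +_) e)))
  (Sum.map (λ e → +-cancelˡ-≡ d _ _ (trans (+-suc d a) e)) (λ e → +-cancelˡ-≡ d _ _ (trans (+-suc d c) e)))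

-- The labels fill the whole interval [lo, hi], since no walk can step over an unused label.
module Linearisation (G : SNGraph) (connected : Connected G) (i₀ : Fin (size G))
  (r : Fin (size G) → ℕ) (r-inj : Injective _≡_ _≡_ r)
  (adjacent : ∀ i j → Neighbours (r i) (r j) ⇔ (adj G i j ≡ true))
  (b : Bool) (seat : ∀ i → alternate b (r i) ≡ isSeat G i) where

  private
    imin imax : Fin (size G)
    imin = proj₁ (argmin-Fin r i₀)
    imax = proj₁ (argmax-Fin r i₀)

    lo hi : ℕ
    lo = r imin
    hi = r imax

    lo≤ : ∀ i → lo ≤ r i
    lo≤ = proj₂ (argmin-Fin r i₀)

    ≤hi : ∀ i → r i ≤ hi
    ≤hi = proj₂ (argmax-Fin r i₀)

    below-gap : ∀ x → (∀ i → r i ≢ x) → ∀ {i j} → Reach G i j → r i < x → r j < x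
    below-gap x gap here ri<x = ri<x
    below-gap x gap (step {j} {k} walk e) ri<x with Equivalence.from (adjacent j k) e
    ... | inj₁ sj≡k = ≤∧≢⇒< (subst (_≤ x) sj≡k (below-gap x gap walk ri<x)) (gap k)
    ... | inj₂ sk≡j = <-trans (≤-reflexive sk≡j) (below-gap x gap walk ri<x)

    label-onto : ∀ x → lo ≤ x → x ≤ hi → ∃ λ i → r i ≡ x
    label-onto x lo≤x x≤hi with Fin.any? (λ i → r i ≟ x)
    ... | yes found = found
    ... | no unused = ⊥-elim (<⇒≱ (below-gap x gap (connected imin imax) (≤∧≢⇒< lo≤x (gap imin))) x≤hi)
      where
      gap : ∀ i → r i ≢ x
      gap i e = unused (i , e)

    L : ℕ
    L = suc (hi ∸ lo)

    to : Fin (size G) → Fin L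
    to i = fromℕ< (s≤s (∸-monoˡ-≤ lo (≤hi i)))

    offset : ∀ i → lo + toℕ (to i) ≡ r i
    offset i = trans (cong (lo +_) (toℕ-fromℕ< _)) (m+[n∸m]≡n (lo≤ i))

    in-range : ∀ (t : Fin L) → lo + toℕ t ≤ hi
    in-range t = ≤-trans (+-monoʳ-≤ lo (s≤s⁻¹ (toℕ<n t))) (≤-reflexive (m+[n∸m]≡n (lo≤ imax)))

    from : Fin L → Fin (size G)
    from t = proj₁ (label-onto (lo + toℕ t) (m≤m+n lo _) (in-range t))

    r-from : ∀ t → r (from t) ≡ lo + toℕ t
    r-from t = proj₂ (label-onto (lo + toℕ t) (m≤m+n lo _) (in-range t))

    to-from : ∀ t → to (from t) ≡ t
    to-from t = toℕ-injective (begin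
      toℕ (to (from t))  ≡⟨ toℕ-fromℕ< _ ⟩
      r (from t) ∸ lo    ≡⟨ cong (_∸ lo) (r-from t) ⟩
      lo + toℕ t ∸ lo    ≡⟨ m+n∸m≡n lo (toℕ t) ⟩
      toℕ t              ∎)

    from-to : ∀ i → from (to i) ≡ i
    from-to i = r-inj (trans (r-from (to i)) (offset i))

  linearisation : G ≅ path (alternate b lo) L
  linearisation = ≅-path (mk↔ₛ′ to from to-from from-to)
    (λ i → trans (sym (alternate-+ b lo _)) (trans (cong (alternate b) (offset i)) (seat i)))
    (λ i j → mk⇔
      (Equivalence.to (adjacent i j) ∘ subst₂ Neighbours (offset i) (offset j) ∘ Equivalence.to (Neighbours-+ˡ lo))
      (Equivalence.from (Neighbours-+ˡ lo) ∘ subst₂ Neighbours (sym (offset i)) (sym (offset j))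
        ∘ Equivalence.from (adjacent i j)))

CyclicSucc : ℕ → ℕ → ℕ → Set
CyclicSucc M a c = suc a ≡ c ⊎ (suc a ≡ M × c ≡ 0)

CyclicNeighbours : ℕ → ℕ → ℕ → Set
CyclicNeighbours M a c = CyclicSucc M a c ⊎ CyclicSucc M c a

Neighbours⇒CyclicNeighbours : ∀ {M a c} → Neighbours a c → CyclicNeighbours M a c
Neighbours⇒CyclicNeighbours = Sum.map inj₁ inj₁

CyclicNeighbours-2⇒Neighbours : ∀ {a c} → CyclicNeighbours 2 a c → Neighbours a c
CyclicNeighbours-2⇒Neighbours = Sum.[ Sum.[ inj₁ , inj₂ ∘ wrap ] , Sum.[ inj₂ , inj₁ ∘ wrap ] ]
  where
  wrap : ∀ {x y} → suc x ≡ 2 × y ≡ 0 → suc y ≡ x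
  wrap (e , refl) = sym (suc-injective e)

CyclicNeighbours-positive : ∀ {M a c} → 0 < a → 0 < c → CyclicNeighbours M a c → Neighbours a c
CyclicNeighbours-positive 0<a 0<c = Sum.map (Sum.[ id , (λ { (_ , refl) → ⊥-elim (<-irrefl refl 0<c) }) ])
                                            (Sum.[ id , (λ { (_ , refl) → ⊥-elim (<-irrefl refl 0<a) }) ])

CyclicNeighbours-parity : ∀ N {a c} → CyclicNeighbours (N + N) a c → alternate true c ≡ not (alternate true a)
CyclicNeighbours-parity N {a} (inj₁ (inj₁ refl)) = sym (not-alternate true a)
CyclicNeighbours-parity N {c = c} (inj₂ (inj₁ refl)) =
  sym (trans (cong not (sym (not-alternate true c))) (not-involutive (alternate true c)))
CyclicNeighbours-parity N {a} (inj₁ (inj₂ (sa≡M , refl))) = sym (begin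
  not (alternate true a)    ≡⟨ not-alternate true a ⟩
  alternate true (suc a)    ≡⟨ cong (alternate true) sa≡M ⟩
  alternate true (N + N)    ≡⟨ alternate-double true N ⟩
  true                      ∎)
CyclicNeighbours-parity N {c = c} (inj₂ (inj₂ (sc≡M , refl))) = begin
  alternate true c               ≡⟨ not-involutive (alternate true c) ⟨
  not (not (alternate true c))   ≡⟨ cong not (not-alternate true c) ⟩
  not (alternate true (suc c))   ≡⟨ cong (not ∘ alternate true) sc≡M ⟩
  not (alternate true (N + N))   ≡⟨ cong not (alternate-double true N) ⟩
  false                          ∎

double-injective : ∀ {a c} → a + a ≡ c + c → a ≡ c
double-injective {a} {c} e = trans (n≡⌊n+n/2⌋ a) (trans (cong ⌊_/2⌋ e) (sym (n≡⌊n+n/2⌋ c)))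

suc-double : ∀ c → suc c + suc c ≡ suc (suc (c + c))
suc-double c = cong suc (+-suc c c)

halve : ∀ x → ∃ λ h → x ≡ h + h ⊎ x ≡ suc (h + h)
halve zero          = 0 , inj₁ refl
halve (suc zero)    = 0 , inj₂ refl
halve (suc (suc x)) with halve x
... | h , inj₁ refl = suc h , inj₁ (sym (suc-double h))
... | h , inj₂ refl = suc h , inj₂ (cong suc (sym (suc-double h)))

double-<-cancel : ∀ {h N} → h + h < N + N → h < N
double-<-cancel {h} {N} hh<NN with h <? N
... | yes h<N = h<N
... | no  h≮N = ⊥-elim (<⇒≱ hh<NN (+-mono-≤ (≮⇒≥ h≮N) (≮⇒≥ h≮N)))

module Table (N : ℕ) where

  M : ℕ
  M = N + N

  position : TV N → ℕ
  position (inj₁ s) = toℕ s + toℕ s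
  position (inj₂ k) = suc (toℕ k + toℕ k)

  alternate-position : ∀ u → alternate true (position u) ≡ tvIsSeat u
  alternate-position (inj₁ s) = alternate-double true (toℕ s)
  alternate-position (inj₂ k) = alternate-double false (toℕ k)

  same-kind : ∀ {u v} → position u ≡ position v → tvIsSeat u ≡ tvIsSeat v
  same-kind {u} {v} e = trans (sym (alternate-position u)) (trans (cong (alternate true) e) (alternate-position v))

  position-injective : Injective _≡_ _≡_ position
  position-injective {inj₁ s} {inj₁ s′} e = cong inj₁ (toℕ-injective (double-injective e))
  position-injective {inj₂ k} {inj₂ k′} e = cong inj₂ (toℕ-injective (double-injective (suc-injective e)))
  position-injective {inj₁ s} {inj₂ k}  e with () ← same-kind {inj₁ s} {inj₂ k} e
  position-injective {inj₂ k} {inj₁ s}  e with () ← same-kind {inj₂ k} {inj₁ s} e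

  position< : ∀ u → position u < M
  position< (inj₁ s) = +-mono-< (toℕ<n s) (toℕ<n s)
  position< (inj₂ k) = subst (_≤ M) (suc-double (toℕ k)) (+-mono-≤ (toℕ<n k) (toℕ<n k))

  vertex-at : ∀ x → x < M → ∃ λ u → position u ≡ x
  vertex-at x x<M with halve x
  ... | h , inj₁ refl = inj₁ (fromℕ< h<N) , cong (λ y → y + y) (toℕ-fromℕ< h<N)
    where h<N = double-<-cancel {h} x<M
  ... | h , inj₂ refl = inj₂ (fromℕ< h<N) , cong (λ y → suc (y + y)) (toℕ-fromℕ< h<N)
    where h<N = double-<-cancel {h} (<-trans (n<1+n (h + h)) x<M)

  seat-napkin : ∀ s k → NapAdj N s k ⇔ CyclicNeighbours M (position (inj₁ s)) (position (inj₂ k))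
  seat-napkin s k = mk⇔ to from
    where
    a = toℕ s
    c = toℕ k
    to : NapAdj N s k → CyclicNeighbours M (a + a) (suc (c + c))
    to (inj₁ c≡a)                  = inj₁ (inj₁ (cong (λ y → suc (y + y)) (sym c≡a)))
    to (inj₂ (inj₁ sc≡a))          = inj₂ (inj₁ (trans (sym (suc-double c)) (cong (λ y → y + y) sc≡a)))
    to (inj₂ (inj₂ (s≡0 , sc≡N)))  =
      inj₂ (inj₂ (trans (sym (suc-double c)) (cong (λ y → y + y) sc≡N) , cong (λ y → y + y) s≡0))
    from : CyclicNeighbours M (a + a) (suc (c + c)) → NapAdj N s k
    from (inj₁ (inj₁ e))              = inj₁ (sym (double-injective (suc-injective e)))
    from (inj₁ (inj₂ (_ , ())))
    from (inj₂ (inj₁ e))              = inj₂ (inj₁ (double-injective (trans (suc-double c) e)))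
    from (inj₂ (inj₂ (e₁ , e₀)))      =
      inj₂ (inj₂ (double-injective {a} {0} e₀ , double-injective (trans (suc-double c) e₁)))

  other-kind : ∀ {u v} → CyclicNeighbours M (position u) (position v) → tvIsSeat v ≡ not (tvIsSeat u)
  other-kind {u} {v} cn = begin
    tvIsSeat v                        ≡⟨ alternate-position v ⟨
    alternate true (position v)       ≡⟨ CyclicNeighbours-parity N cn ⟩
    not (alternate true (position u)) ≡⟨ cong not (alternate-position u) ⟩
    not (tvIsSeat u)                  ∎

  TAdj⇔CyclicNeighbours : ∀ u v → TAdj N u v ⇔ CyclicNeighbours M (position u) (position v)
  TAdj⇔CyclicNeighbours (inj₁ s) (inj₂ k) = seat-napkin s k
  TAdj⇔CyclicNeighbours (inj₂ k) (inj₁ s) = ⇔.trans (seat-napkin s k) (mk⇔ swap swap)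
  TAdj⇔CyclicNeighbours (inj₁ s) (inj₁ s′) =
    mk⇔ (λ ()) (λ cn → case other-kind {inj₁ s} {inj₁ s′} cn of λ ())
  TAdj⇔CyclicNeighbours (inj₂ k) (inj₂ k′) =
    mk⇔ (λ ()) (λ cn → case other-kind {inj₂ k} {inj₂ k′} cn of λ ())

-- Cutting the circle 0, …, M-1 at an unused position q: the positions after q come first.
module Rotation (M q : ℕ) (q<M : q < M) where

  d e : ℕ
  d = suc q
  e = M ∸ d

  d+e≡M : d + e ≡ M
  d+e≡M = m+[n∸m]≡n q<M

  rotate-by : ∀ x → Dec (q < x) → ℕ
  rotate-by x (yes _) = x ∸ d
  rotate-by x (no  _) = x + e

  rotate : ℕ → ℕ
  rotate x = rotate-by x (q <? x)

  data Side (x : ℕ) : Set where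
    after  : q < x → rotate x + d ≡ x → Side x
    before : x < q → rotate x ≡ x + e → Side x

  side : ∀ x → x ≢ q → Side x
  side x x≢q with q <? x in eq
  ... | yes q<x = after q<x (trans (cong (λ D → rotate-by x D + d) eq) (m∸n+n≡m q<x))
  ... | no  q≮x = before (≤∧≢⇒< (≮⇒≥ q≮x) x≢q) (cong (rotate-by x) eq)

  after-small : ∀ {x} → x < M → rotate x + d ≡ x → rotate x < e
  after-small {x} x<M r+d≡x = +-cancelʳ-< d (rotate x) e
    (subst₂ _<_ (sym r+d≡x) (trans (sym d+e≡M) (+-comm d e)) x<M)

  before-large : ∀ {x} → rotate x ≡ x + e → e ≤ rotate x
  before-large {x} r≡x+e = subst (e ≤_) (sym r≡x+e) (m≤n+m e x)

  rotate-injective : ∀ {x y} → x < M → y < M → Side x → Side y → rotate x ≡ rotate y → x ≡ y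
  rotate-injective _ _ (after _ rx) (after _ ry) r = trans (sym rx) (trans (cong (_+ d) r) ry)
  rotate-injective _ _ (before _ rx) (before _ ry) r = +-cancelʳ-≡ e _ _ (trans (sym rx) (trans r ry))
  rotate-injective x<M _ (after _ rx) (before _ ry) r =
    ⊥-elim (<⇒≱ (after-small x<M rx) (subst (e ≤_) (sym r) (before-large ry)))
  rotate-injective _ y<M (before _ rx) (after _ ry) r =
    ⊥-elim (<⇒≱ (after-small y<M ry) (subst (e ≤_) r (before-large rx)))

  CyclicSucc⇒rotate-succ : ∀ {x y} → Side x → Side y → CyclicSucc M x y → suc (rotate x) ≡ rotate y
  CyclicSucc⇒rotate-succ (after _ rx) (after _ ry) (inj₁ refl) = +-cancelʳ-≡ d _ _ (trans (cong suc rx) (sym ry))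
  CyclicSucc⇒rotate-succ (before _ rx) (before _ ry) (inj₁ refl) = trans (cong suc rx) (sym ry)
  CyclicSucc⇒rotate-succ {x} (after q<x _) (before y<q _) (inj₁ refl) = ⊥-elim (<-asym q<x (<-trans (n<1+n x) y<q))
  CyclicSucc⇒rotate-succ (before x<q _) (after q<y _) (inj₁ refl) = ⊥-elim (<⇒≱ q<y x<q)
  CyclicSucc⇒rotate-succ {x} (after _ rx) (before _ ry) (inj₂ (sx≡M , refl)) = +-cancelʳ-≡ d _ _ (begin
    suc (rotate x) + d   ≡⟨ cong suc rx ⟩
    suc x                ≡⟨ sx≡M ⟩
    M                    ≡⟨ d+e≡M ⟨
    d + e                ≡⟨ +-comm d e ⟩
    e + d                ≡⟨ cong (_+ d) ry ⟨
    rotate 0 + d         ∎)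
  CyclicSucc⇒rotate-succ (before x<q _) _ (inj₂ (sx≡M , _)) = ⊥-elim (<⇒≱ q<M (subst (_≤ q) sx≡M x<q))
  CyclicSucc⇒rotate-succ _ (after q<0 _) (inj₂ (_ , refl)) = ⊥-elim (n≮0 q<0)

  rotate-succ⇒CyclicSucc : ∀ {x y} → x < M → y < M → Side x → Side y →
                           suc (rotate x) ≡ rotate y → CyclicSucc M x y
  rotate-succ⇒CyclicSucc _ _ (after _ rx) (after _ ry) s = inj₁ (trans (cong suc (sym rx)) (trans (cong (_+ d) s) ry))
  rotate-succ⇒CyclicSucc _ _ (before _ rx) (before _ ry) s =
    inj₁ (+-cancelʳ-≡ e _ _ (trans (cong suc (sym rx)) (trans s ry)))
  rotate-succ⇒CyclicSucc {x} {y} x<M _ (after _ rx) (before _ ry) s = inj₂ (sx≡M , y≡0)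
    where
    y≡0 : y ≡ 0
    y≡0 = n≤0⇒n≡0 (+-cancelʳ-≤ e y 0 (subst (_≤ e) (trans s ry) (after-small x<M rx)))
    sx≡M : suc x ≡ M
    sx≡M = begin
      suc x                ≡⟨ cong suc (sym rx) ⟩
      suc (rotate x) + d   ≡⟨ cong (_+ d) (trans s (trans ry (cong (_+ e) y≡0))) ⟩
      e + d                ≡⟨ +-comm e d ⟩
      d + e                ≡⟨ d+e≡M ⟩
      M                    ∎
  rotate-succ⇒CyclicSucc _ y<M (before _ rx) (after _ ry) s =
    ⊥-elim (<⇒≱ (after-small y<M ry) (≤-trans (before-large rx) (≤-trans (n≤1+n _) (≤-reflexive s))))

  rotate-neighbours : ∀ {x y} → x < M → y < M → Side x → Side y →
                      Neighbours (rotate x) (rotate y) ⇔ CyclicNeighbours M x y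
  rotate-neighbours x<M y<M sx sy = mk⇔
    (Sum.map (rotate-succ⇒CyclicSucc x<M y<M sx sy) (rotate-succ⇒CyclicSucc y<M x<M sy sx))
    (Sum.map (CyclicSucc⇒rotate-succ sx sy) (CyclicSucc⇒rotate-succ sy sx))

  rotate-alternate : ∀ {x} N → M ≡ N + N → Side x → alternate (alternate true d) (rotate x) ≡ alternate true x
  rotate-alternate {x} N M≡N+N (after _ rx) = begin
    alternate (alternate true d) (rotate x)  ≡⟨ alternate-+ true d (rotate x) ⟨
    alternate true (d + rotate x)            ≡⟨ cong (alternate true) (trans (+-comm d _) rx) ⟩
    alternate true x                         ∎
  rotate-alternate {x} N M≡N+N (before _ rx) = begin
    alternate c (rotate x)       ≡⟨ cong (alternate c) (trans rx (+-comm x e)) ⟩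
    alternate c (e + x)          ≡⟨ alternate-+ c e x ⟩
    alternate (alternate c e) x  ≡⟨ cong (λ b → alternate b x) c-e≡true ⟩
    alternate true x             ∎
    where
    c : Bool
    c = alternate true d
    c-e≡true : alternate c e ≡ true
    c-e≡true = begin
      alternate c e             ≡⟨ alternate-+ true d e ⟨
      alternate true (d + e)    ≡⟨ cong (alternate true) (trans d+e≡M M≡N+N) ⟩
      alternate true (N + N)    ≡⟨ alternate-double true N ⟩
      true                      ∎

covering-cycle : ∀ G {M} (label : Fin (size G) → ℕ) → 3 ≤ M →
                 (∀ i j → CyclicSucc M (label i) (label j) → adj G i j ≡ true) →
                 (∀ x → x < M → ∃ λ i → label i ≡ x) → HasCycle G
covering-cycle G {suc zero}       label (s≤s ())
covering-cycle G {suc (suc zero)} label (s≤s (s≤s ()))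
covering-cycle G {suc (suc (suc k))} label _ succ-adj covers = k , c , c-injective , consecutive , closing
  where
  c : Fin (suc (suc (suc k))) → Fin (size G)
  c t = proj₁ (covers (toℕ t) (toℕ<n t))
  label-c : ∀ t → label (c t) ≡ toℕ t
  label-c t = proj₂ (covers (toℕ t) (toℕ<n t))
  c-injective : Injective _≡_ _≡_ c
  c-injective {t} {u} e = toℕ-injective (trans (sym (label-c t)) (trans (cong label e) (label-c u)))
  consecutive : ∀ (i : Fin (suc (suc k))) → adj G (c (inject₁ i)) (c (suc i)) ≡ true
  consecutive i = succ-adj _ _
    (inj₁ (trans (cong suc (trans (label-c (inject₁ i)) (toℕ-inject₁ i))) (sym (label-c (suc i)))))
  closing : adj G (c (fromℕ (suc (suc k)))) (c zero) ≡ true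
  closing = succ-adj _ _ (inj₂ (cong suc (trans (label-c _) (toℕ-fromℕ _)) , label-c zero))

module TableComponent {G : SNGraph} {N} {st : TableState N} {f : Fin (size G) → TV N}
                      (embedding : ComponentEmbedding G N st f) where
  open Table N
  open ComponentEmbedding embedding

  label : Fin (size G) → ℕ
  label = position ∘ f

  label-injective : Injective _≡_ _≡_ label
  label-injective = inj ∘ position-injective

  label-adjacent : ∀ i j → CyclicNeighbours M (label i) (label j) ⇔ (adj G i j ≡ true)
  label-adjacent i j = ⇔.sym (⇔.trans (adjacency i j) (TAdj⇔CyclicNeighbours (f i) (f j)))

  label-seat : ∀ i → alternate true (label i) ≡ isSeat G i
  label-seat i = trans (alternate-position (f i)) (sym (seat i))

  path-if-single-seat : Fin (size G) → N ≡ 1 → ∃₂ λ b L → G ≅ path b L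
  path-if-single-seat i₀ refl = _ , _ , Linearisation.linearisation G connected i₀ label label-injective
    (λ i j → ⇔.trans (mk⇔ Neighbours⇒CyclicNeighbours CyclicNeighbours-2⇒Neighbours) (label-adjacent i j))
    true label-seat

  path-if-gap : Fin (size G) → ∀ q → q < M → (∀ i → label i ≢ q) → ∃₂ λ b L → G ≅ path b L
  path-if-gap i₀ q q<M gap =
    _ , _ , Linearisation.linearisation G connected i₀ (rotate ∘ label) rotated-injective adjacent
                                        (alternate true d) seat′
    where
    open Rotation M q q<M
    sides : ∀ i → Side (label i)
    sides i = side (label i) (gap i)
    rotated-injective : Injective _≡_ _≡_ (rotate ∘ label)
    rotated-injective {i} {j} = label-injective ∘ rotate-injective (position< (f i)) (position< (f j)) (sides i) (sides j)
    adjacent : ∀ i j → Neighbours (rotate (label i)) (rotate (label j)) ⇔ (adj G i j ≡ true)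
    adjacent i j = ⇔.trans (rotate-neighbours (position< (f i)) (position< (f j)) (sides i) (sides j)) (label-adjacent i j)
    seat′ : ∀ i → alternate (alternate true d) (rotate (label i)) ≡ isSeat G i
    seat′ i = trans (rotate-alternate N refl (sides i)) (label-seat i)

  path-or-cycle : Fin (size G) → 2 ≤ N → (∃₂ λ b L → G ≅ path b L) ⊎ HasCycle G
  path-or-cycle i₀ 2≤N with Fin.all? (λ (x : Fin M) → Fin.any? (λ i → label i ≟ toℕ x))
  ... | yes covers =
    inj₂ (covering-cycle G label 3≤M (λ i j → Equivalence.to (label-adjacent i j) ∘ inj₁) covers′)
    where
    3≤M : 3 ≤ M
    3≤M = ≤-trans (n≤1+n 3) (+-mono-≤ 2≤N 2≤N)
    covers′ : ∀ x → x < M → ∃ λ i → label i ≡ x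
    covers′ x x<M = let i , e = covers (fromℕ< x<M) in i , trans e (toℕ-fromℕ< x<M)
  ... | no uncovered =
    let x , unused = Fin.¬∀⟶∃¬ M (λ x → ∃ λ i → label i ≡ toℕ x)
                                  (λ x → Fin.any? (λ i → label i ≟ toℕ x)) uncovered
    in inj₁ (path-if-gap i₀ (toℕ x) (toℕ<n x) (λ i e → unused (i , e)))

component-path : ∀ {G n st f} → Acyclic G → Fin (size G) → ComponentEmbedding G (suc n) st f →
                 ∃₂ λ b L → G ≅ path b L
component-path {n = zero}  _ i₀ embedding = path-if-single-seat i₀ refl
  where open TableComponent embedding
component-path {n = suc m} acyclic i₀ embedding =
  Sum.[ id , ⊥-elim ∘ acyclic ] (path-or-cycle i₀ (s≤s (s≤s z≤n)))
  where open TableComponent embedding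

countTrue-inhabited : ∀ {m} (f : Fin m → Bool) → 0 < countTrue f → Fin m
countTrue-inhabited {zero}  _ ()
countTrue-inhabited {suc m} _ _ = zero

interval-path : ∀ {G} → Interval G → ∃₂ λ b L → G ≅ path b L
interval-path {G} (acyclic , seats>0 , _ , _ , _ , _ , embedding) =
  component-path acyclic (countTrue-inhabited (isSeat G) seats>0) embedding

classify-path : ∀ b L → InnerFacing (path b L) ⊎ OuterFacing (path b L) ⊎ Asymmetric (path b L)
classify-path true L with alternations-balanced L
... | inj₁ balanced = inj₂ (inj₂ (trans (numNapkins-path true L) (sym balanced)))
... | inj₂ one-more = inj₁ (trans (cong (_+ 1) (numNapkins-path true L)) (trans (+-comm _ 1) (sym one-more)))
classify-path false L with alternations-balanced L
... | inj₁ balanced = inj₂ (inj₂ (trans (numNapkins-path false L) balanced))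
... | inj₂ one-more = inj₂ (inj₁ (trans (numNapkins-path false L) (trans one-more (+-comm 1 _))))

HasType-≅ : ∀ t {G H} → G ≅ H → HasType t H → HasType t G
HasType-≅ inner φ = subst₂ (λ s k → k + 1 ≡ s) (sym (≅-numSeats φ)) (sym (≅-numNapkins φ))
HasType-≅ outer φ = subst₂ (λ s k → k ≡ s + 1) (sym (≅-numSeats φ)) (sym (≅-numNapkins φ))
HasType-≅ asym  φ = subst₂ (λ s k → k ≡ s) (sym (≅-numSeats φ)) (sym (≅-numNapkins φ))

HasType-numNapkins : ∀ t {G H} → HasType t G → HasType t H →
                     numSeats G ≡ numSeats H → numNapkins G ≡ numNapkins H
HasType-numNapkins inner hG hH seats = +-cancelʳ-≡ 1 _ _ (trans hG (trans seats (sym hH)))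
HasType-numNapkins outer hG hH seats = trans hG (trans (cong (_+ 1) seats) (sym hH))
HasType-numNapkins asym  hG hH seats = trans hG (trans seats (sym hH))

path-length : ∀ {b b′ L L′} → alternations b L ≡ alternations b′ L′ →
              alternations (not b) L ≡ alternations (not b′) L′ → L ≡ L′
path-length {b} {b′} {L} {L′} seats napkins =
  trans (sym (alternations-sum b L)) (trans (cong₂ _+_ seats napkins) (alternations-sum b′ L′))

balanced-even : ∀ b L → alternations b L ≡ alternations (not b) L → L ≡ alternations b L + alternations b L
balanced-even b L balanced = trans (sym (alternations-sum b L)) (cong (alternations b L +_) (sym balanced))

path-reverse-balanced : ∀ b L → alternations b L ≡ alternations (not b) L → path b L ≅ path (not b) L
path-reverse-balanced b L balanced =
  subst (λ n → path b n ≅ path (not b) n) (sym (balanced-even b L balanced)) (path-reverse b (alternations b L))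

path-unique : ∀ {b b′ L L′} → alternations b L ≡ alternations b′ L′ →
              alternations (not b) L ≡ alternations (not b′) L′ → path b L ≅ path b′ L′
path-unique {b} {b′} {L} {L′} seats napkins with path-length {b} {b′} {L} {L′} seats napkins
path-unique {true}  {true}      _     _ | refl = ≅-refl
path-unique {false} {false}     _     _ | refl = ≅-refl
path-unique {true}  {false} {L} seats _ | refl = path-reverse-balanced true L seats
path-unique {false} {true}  {L} seats _ | refl = path-reverse-balanced false L seats

interval-classification : ∀ G → Interval G → InnerFacing G ⊎ OuterFacing G ⊎ Asymmetric G
interval-classification G I =
  let b , L , φ = interval-path I
  in Sum.map (HasType-≅ inner φ) (Sum.map (HasType-≅ outer φ) (HasType-≅ asym φ)) (classify-path b L)

interval-unique : ∀ t {G H} → Interval G → Interval H → numSeats G ≡ numSeats H →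
                  HasType t G → HasType t H → G ≅ H
interval-unique t {G} {H} IG IH seats hG hH =
  let b , L , φ = interval-path IG
      b′ , L′ , ψ = interval-path IH
      path-seats : alternations b L ≡ alternations b′ L′
      path-seats = trans (sym (≅-numSeats φ)) (trans seats (≅-numSeats ψ))
      path-napkins : alternations (not b) L ≡ alternations (not b′) L′
      path-napkins = begin
        alternations (not b) L      ≡⟨ numNapkins-path b L ⟨
        numNapkins (path b L)       ≡⟨ ≅-numNapkins φ ⟨
        numNapkins G                ≡⟨ HasType-numNapkins t hG hH seats ⟩
        numNapkins H                ≡⟨ ≅-numNapkins ψ ⟩
        numNapkins (path b′ L′)     ≡⟨ numNapkins-path b′ L′ ⟩
        alternations (not b′) L′    ∎
  in ≅-trans φ (≅-trans (path-unique path-seats path-napkins) (≅-sym ψ))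

module ArcEmbedding {n} (st : TableState (suc n)) (p L : ℕ) (0<p : 0 < p) (p+L<M : p + L < suc n + suc n)
  (inside : ∀ v → p ≤ Table.position (suc n) v → Table.position (suc n) v < p + L → Present st v)
  (u₋ u₊ : TV (suc n))
  (u₋-position : suc (Table.position (suc n) u₋) ≡ p) (u₊-position : Table.position (suc n) u₊ ≡ p + L)
  (u₋-absent : ¬ Present st u₋) (u₊-absent : ¬ Present st u₊) where

  open Table (suc n)

  private
    p+t<M : ∀ (t : Fin L) → p + toℕ t < M
    p+t<M t = <-trans (+-monoʳ-< p (toℕ<n t)) p+L<M

  vertex : Fin L → TV (suc n)
  vertex t = proj₁ (vertex-at (p + toℕ t) (p+t<M t))

  private
    position-vertex : ∀ t → position (vertex t) ≡ p + toℕ t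
    position-vertex t = proj₂ (vertex-at (p + toℕ t) (p+t<M t))

    vertex-injective : Injective _≡_ _≡_ vertex
    vertex-injective {t} {u} e = toℕ-injective (+-cancelˡ-≡ p _ _
      (trans (sym (position-vertex t)) (trans (cong position e) (position-vertex u))))

    vertex-onto : ∀ v x → x < L → position v ≡ p + x → ∃ λ t → vertex t ≡ v
    vertex-onto v x x<L e = fromℕ< x<L ,
      position-injective (trans (position-vertex _) (trans (cong (p +_) (toℕ-fromℕ< x<L)) (sym e)))

    0<p+ : ∀ x → 0 < p + x
    0<p+ x = ≤-trans 0<p (m≤m+n p x)

    vertex-adjacent : ∀ t u → (adj (path (alternate true p) L) t u ≡ true) ⇔ TAdj (suc n) (vertex t) (vertex u)
    vertex-adjacent t u = ⇔.sym
      (⇔.trans TAdj⇔arc-neighbours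
      (⇔.trans (mk⇔ (CyclicNeighbours-positive (0<p+ _) (0<p+ _)) Neighbours⇒CyclicNeighbours)
      (⇔.trans (⇔.sym (Neighbours-+ˡ p)) (Neighbours⇔neighbours? _ _))))
      where
      TAdj⇔arc-neighbours : TAdj (suc n) (vertex t) (vertex u) ⇔ CyclicNeighbours M (p + toℕ t) (p + toℕ u)
      TAdj⇔arc-neighbours = subst₂ (λ x y → TAdj (suc n) (vertex t) (vertex u) ⇔ CyclicNeighbours M x y)
        (position-vertex t) (position-vertex u) (TAdj⇔CyclicNeighbours (vertex t) (vertex u))

    neighbour-in-arc : ∀ v x → x < L → Present st v → CyclicNeighbours M (p + x) (position v) →
                       ∃ λ t → vertex t ≡ v
    neighbour-in-arc v x x<L present (inj₁ (inj₁ next)) with suc x <? L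
    ... | yes sx<L = vertex-onto v (suc x) sx<L (trans (sym next) (sym (+-suc p x)))
    ... | no  sx≮L = ⊥-elim (u₊-absent (subst (Present st) (position-injective (begin
          position v     ≡⟨ next ⟨
          suc (p + x)    ≡⟨ +-suc p x ⟨
          p + suc x      ≡⟨ cong (p +_) (≤-antisym x<L (≮⇒≥ sx≮L)) ⟩
          p + L          ≡⟨ u₊-position ⟨
          position u₊    ∎)) present))
    neighbour-in-arc v x x<L _ (inj₁ (inj₂ (sp+x≡M , _))) =
      ⊥-elim (<-irrefl sp+x≡M (≤-<-trans (+-monoʳ-< p x<L) p+L<M))
    neighbour-in-arc v zero _ present (inj₂ (inj₁ previous)) =
      ⊥-elim (u₋-absent (subst (Present st) (position-injective (suc-injective
        (trans previous (trans (+-identityʳ p) (sym u₋-position))))) present))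
    neighbour-in-arc v (suc x) sx<L _ (inj₂ (inj₁ previous)) =
      vertex-onto v x (<-trans (n<1+n x) sx<L) (suc-injective (trans previous (+-suc p x)))
    neighbour-in-arc v x _ _ (inj₂ (inj₂ (_ , p+x≡0))) = ⊥-elim (<-irrefl (sym p+x≡0) (0<p+ x))

  arc-embedding : ComponentEmbedding (path (alternate true p) L) (suc n) st vertex
  arc-embedding = record
    { inj       = vertex-injective
    ; present   = λ t → inside (vertex t) (subst (p ≤_) (sym (position-vertex t)) (m≤m+n p _))
                                          (subst (_< p + L) (sym (position-vertex t)) (+-monoʳ-< p (toℕ<n t)))
    ; seat      = λ t → begin
        alternate (alternate true p) (toℕ t)   ≡⟨ alternate-+ true p (toℕ t) ⟨
        alternate true (p + toℕ t)             ≡⟨ cong (alternate true) (position-vertex t) ⟨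
        alternate true (position (vertex t))   ≡⟨ alternate-position (vertex t) ⟩
        tvIsSeat (vertex t)                    ∎
    ; adjacency = vertex-adjacent
    ; connected = path-connected (alternate true p) L
    ; closed    = λ t v present t~v → neighbour-in-arc v (toℕ t) (toℕ<n t) present
        (subst (λ y → CyclicNeighbours M y (position v)) (position-vertex t)
               (Equivalence.to (TAdj⇔CyclicNeighbours (vertex t) v) t~v))
    }

  arc-interval : Reachable (suc n) st → 0 < alternations (alternate true p) L → Interval (path (alternate true p) L)
  arc-interval reachable has-seat =
    path-acyclic (alternate true p) L , has-seat , n , st , reachable , vertex , arc-embedding

setTrue-same : ∀ {N} (f : Fin N → Bool) s → setTrue f s s ≡ true
setTrue-same f s with s Fin.≟ s
... | yes _   = refl
... | no  s≢s = ⊥-elim (s≢s refl)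

setTrue-true : ∀ {N} (f : Fin N → Bool) s {j} → f j ≡ true → setTrue f s j ≡ true
setTrue-true f s {j} fj with j Fin.≟ s
... | yes _ = refl
... | no  _ = fj

setTrue-other : ∀ {N} (f : Fin N → Bool) {s j} → j ≢ s → setTrue f s j ≡ f j
setTrue-other f {s} {j} j≢s with j Fin.≟ s
... | yes j≡s = ⊥-elim (j≢s j≡s)
... | no  _   = refl

-- A left fold, so that setTrueAll f (x ∷ y ∷ []) is setTrue (setTrue f x) y, the shape of the states
-- built by the seating moves.
setTrueAll : ∀ {N} → (Fin N → Bool) → List (Fin N) → Fin N → Bool
setTrueAll = foldl setTrue

setTrueAll-true : ∀ {N} (f : Fin N → Bool) xs {j} → f j ≡ true → setTrueAll f xs j ≡ true
setTrueAll-true f []       fj = fj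
setTrueAll-true f (x ∷ xs) fj = setTrueAll-true (setTrue f x) xs (setTrue-true f x fj)

setTrueAll-∈ : ∀ {N} (f : Fin N → Bool) xs {j} → j ∈ xs → setTrueAll f xs j ≡ true
setTrueAll-∈ f (x ∷ xs) (here refl)  = setTrueAll-true (setTrue f x) xs (setTrue-same f x)
setTrueAll-∈ f (x ∷ xs) (there j∈xs) = setTrueAll-∈ (setTrue f x) xs j∈xs

setTrueAll-∉ : ∀ {N} (f : Fin N → Bool) xs {j} → All (j ≢_) xs → setTrueAll f xs j ≡ f j
setTrueAll-∉ f []       []             = refl
setTrueAll-∉ f (x ∷ xs) (j≢x ∷ j∉xs) = trans (setTrueAll-∉ (setTrue f x) xs j∉xs) (setTrue-other f j≢x)

half-positive : ∀ {a} → 0 < a + a → 0 < a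
half-positive {suc a} _ = s≤s z≤n

half-≤ : ∀ {a c} → a + a < suc c + suc c → a ≤ c
half-≤ {a} lt = s≤s⁻¹ (double-<-cancel {a} lt)

module Witnesses (m : ℕ) where

  n N : ℕ
  n = suc m
  N = suc (suc (suc n))

  open Table N

  iₙ iₙ₊₁ iₙ₊₂ : Fin N
  iₙ   = inject₁ (inject₁ (fromℕ n))
  iₙ₊₁ = inject₁ (fromℕ (suc n))
  iₙ₊₂ = fromℕ (suc (suc n))

  toℕ-iₙ : toℕ iₙ ≡ n
  toℕ-iₙ = trans (toℕ-inject₁ _) (trans (toℕ-inject₁ _) (toℕ-fromℕ n))

  toℕ-iₙ₊₁ : toℕ iₙ₊₁ ≡ suc n
  toℕ-iₙ₊₁ = trans (toℕ-inject₁ _) (toℕ-fromℕ (suc n))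

  toℕ-iₙ₊₂ : toℕ iₙ₊₂ ≡ suc (suc n)
  toℕ-iₙ₊₂ = toℕ-fromℕ (suc (suc n))

  none : Fin N → Bool
  none _ = false

  diners : List (Fin N)
  diners = zero ∷ iₙ₊₁ ∷ iₙ₊₂ ∷ []

  below-iₙ₊₁ : ∀ {j} → toℕ j ≤ n → j ≢ iₙ₊₁
  below-iₙ₊₁ {j} j≤n = Fin.<⇒≢ (subst (toℕ j <_) (sym toℕ-iₙ₊₁) (s≤s j≤n))

  below-iₙ₊₂ : ∀ {j} → toℕ j ≤ n → j ≢ iₙ₊₂
  below-iₙ₊₂ {j} j≤n = Fin.<⇒≢ (subst (toℕ j <_) (sym toℕ-iₙ₊₂) (s≤s (≤-trans j≤n (n≤1+n n))))

  free-between : ∀ {j} → 0 < toℕ j → toℕ j ≤ n → All (j ≢_) diners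
  free-between 0<j j≤n = ≢-sym (Fin.<⇒≢ 0<j) ∷ below-iₙ₊₁ j≤n ∷ below-iₙ₊₂ j≤n ∷ []

  iₙ₊₂-free : All (iₙ₊₂ ≢_) (zero ∷ iₙ₊₁ ∷ [])
  iₙ₊₂-free = (λ ()) ∷ Fin.fromℕ≢inject₁ ∷ []

  window-fits : suc (suc (n + n)) < M
  window-fits = s≤s (s≤s (s≤s (+-monoʳ-≤ n (m≤n+m n 3))))

  position-iₙ₊₁ : position (inj₁ iₙ₊₁) ≡ suc (suc (n + n))
  position-iₙ₊₁ = trans (cong (λ y → y + y) toℕ-iₙ₊₁) (suc-double n)

  seat-window : ∀ {s} → 0 < position (inj₁ s) → position (inj₁ s) < suc (suc (n + n)) → All (s ≢_) diners
  seat-window {s} 0<2s 2s<bound =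
    free-between (half-positive 0<2s) (half-≤ {toℕ s} (subst (toℕ s + toℕ s <_) (sym (suc-double n)) 2s<bound))

  absent : ∀ xs {j} → j ∈ xs → ¬ (setTrueAll none xs j ≡ false)
  absent xs j∈xs = not-¬ (setTrueAll-∈ none xs j∈xs)

  -- Asymmetric: every diner takes the napkin on their right.
  asym-state : TableState N
  asym-state = ⟨ setTrueAll none diners , setTrueAll none diners ⟩

  asym-reachable : Reachable N asym-state
  asym-reachable =
    sit-take iₙ₊₂ iₙ₊₂ (sit-take iₙ₊₁ iₙ₊₁ (sit-take zero zero start refl (inj₁ refl) refl) refl (inj₁ refl) refl)
      (setTrueAll-∉ none (zero ∷ iₙ₊₁ ∷ []) iₙ₊₂-free) (inj₁ refl)
      (setTrueAll-∉ none (zero ∷ iₙ₊₁ ∷ []) iₙ₊₂-free)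

  asym-interval : Interval (path true (n + n))
  asym-interval = ArcEmbedding.arc-interval asym-state 2 (n + n) (s≤s z≤n) window-fits inside
    (inj₂ zero) (inj₁ iₙ₊₁) refl position-iₙ₊₁ (absent diners (here refl)) (absent diners (there (here refl)))
    asym-reachable (subst (0 <_) (sym (alternations-double true n)) (s≤s z≤n))
    where
    inside : ∀ v → 2 ≤ position v → position v < 2 + (n + n) → Present asym-state v
    inside (inj₁ s) 2≤2s 2s<b = setTrueAll-∉ none diners (seat-window {s} (≤-trans (s≤s z≤n) 2≤2s) 2s<b)
    inside (inj₂ k) 2≤2k+1 2k+1<b = setTrueAll-∉ none diners (free-between (half-positive (s≤s⁻¹ 2≤2k+1))
      (half-≤ {toℕ k} (subst (toℕ k + toℕ k <_) (sym (suc-double n)) (<-trans (n<1+n _) 2k+1<b))))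

  -- Inner-facing: the diner at seat n+1 takes the napkin on their left instead.
  inner-napkins : List (Fin N)
  inner-napkins = zero ∷ iₙ ∷ iₙ₊₂ ∷ []

  inner-state : TableState N
  inner-state = ⟨ setTrueAll none diners , setTrueAll none inner-napkins ⟩

  inner-reachable : Reachable N inner-state
  inner-reachable =
    sit-take iₙ₊₂ iₙ₊₂ (sit-take iₙ₊₁ iₙ (sit-take zero zero start refl (inj₁ refl) refl) refl
                         (inj₂ (inj₁ (trans (cong suc toℕ-iₙ) (sym toℕ-iₙ₊₁)))) refl)
      (setTrueAll-∉ none (zero ∷ iₙ₊₁ ∷ []) iₙ₊₂-free) (inj₁ refl)
      (setTrueAll-∉ none (zero ∷ iₙ ∷ []) ((λ ()) ∷ Fin.fromℕ≢inject₁ ∷ []))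

  inner-bound : 2 + suc (m + m) ≤ suc (suc (n + n))
  inner-bound = s≤s (s≤s (s≤s (+-monoʳ-≤ m (n≤1+n m))))

  inner-interval : Interval (path true (suc (m + m)))
  inner-interval = ArcEmbedding.arc-interval inner-state 2 (suc (m + m)) (s≤s z≤n) (≤-<-trans inner-bound window-fits)
    inside (inj₂ zero) (inj₂ iₙ) refl (cong suc (trans (cong (λ y → y + y) toℕ-iₙ) (suc-double m)))
    (absent inner-napkins (here refl)) (absent inner-napkins (there (here refl)))
    inner-reachable (s≤s z≤n)
    where
    inside : ∀ v → 2 ≤ position v → position v < 2 + suc (m + m) → Present inner-state v
    inside (inj₁ s) 2≤2s 2s<b =
      setTrueAll-∉ none diners (seat-window {s} (≤-trans (s≤s z≤n) 2≤2s) (<-≤-trans 2s<b inner-bound))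
    inside (inj₂ k) 2≤2k+1 2k+1<b = setTrueAll-∉ none inner-napkins
      (≢-sym (Fin.<⇒≢ 0<k) ∷ Fin.<⇒≢ (subst (toℕ k <_) (sym toℕ-iₙ) (s≤s k≤m))
        ∷ below-iₙ₊₂ (≤-trans k≤m (n≤1+n m)) ∷ [])
      where
      0<k : 0 < toℕ k
      0<k = half-positive (s≤s⁻¹ 2≤2k+1)
      k≤m : toℕ k ≤ m
      k≤m = half-≤ {toℕ k} (subst (toℕ k + toℕ k <_) (sym (suc-double m)) (s≤s⁻¹ 2k+1<b))

  -- Outer-facing: the diner at seat 0 takes the napkin on their left, leaving none for seat n+2.
  outer-napkins : List (Fin N)
  outer-napkins = iₙ₊₂ ∷ iₙ₊₁ ∷ []

  outer-state : TableState N
  outer-state = ⟨ setTrueAll none diners , setTrueAll none outer-napkins ⟩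

  outer-reachable : Reachable N outer-state
  outer-reachable =
    sit-none iₙ₊₂ (sit-take iₙ₊₁ iₙ₊₁ (sit-take zero iₙ₊₂ start refl (inj₂ (inj₂ (refl , cong suc toℕ-iₙ₊₂))) refl)
                     refl (inj₁ refl) (setTrueAll-∉ none (iₙ₊₂ ∷ []) {iₙ₊₁} ((Fin.fromℕ≢inject₁ ∘ sym) ∷ [])))
      (setTrueAll-∉ none (zero ∷ iₙ₊₁ ∷ []) iₙ₊₂-free) surrounded
    where
    surrounded : ∀ k → NapAdj N iₙ₊₂ k → setTrueAll none outer-napkins k ≡ true
    surrounded k (inj₁ k≡iₙ₊₂) = setTrueAll-∈ none outer-napkins (here (toℕ-injective k≡iₙ₊₂))
    surrounded k (inj₂ (inj₁ sk≡iₙ₊₂)) = setTrueAll-∈ none outer-napkins (there (here (toℕ-injective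
      (suc-injective (trans sk≡iₙ₊₂ (trans toℕ-iₙ₊₂ (cong suc (sym toℕ-iₙ₊₁))))))))

  outer-interval : Interval (path false (suc (n + n)))
  outer-interval = ArcEmbedding.arc-interval outer-state 1 (suc (n + n)) (s≤s z≤n) window-fits inside
    (inj₁ zero) (inj₁ iₙ₊₁) refl position-iₙ₊₁ (absent diners (here refl)) (absent diners (there (here refl)))
    outer-reachable (subst (0 <_) (sym (alternations-double true n)) (s≤s z≤n))
    where
    inside : ∀ v → 1 ≤ position v → position v < 1 + suc (n + n) → Present outer-state v
    inside (inj₁ s) 1≤2s 2s<b = setTrueAll-∉ none diners (seat-window {s} 1≤2s 2s<b)
    inside (inj₂ k) _ 2k+1<b = setTrueAll-∉ none outer-napkins (below-iₙ₊₂ k≤n ∷ below-iₙ₊₁ k≤n ∷ [])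
      where
      k≤n : toℕ k ≤ n
      k≤n = half-≤ {toℕ k} (subst (toℕ k + toℕ k <_) (sym (suc-double n)) (<-trans (n<1+n _) 2k+1<b))

  witness : ∀ t → ∃ λ G → Interval G × len G ≡ n × HasType t G
  witness inner = path true (suc (m + m)) , inner-interval , cong suc (alternations-double false m) , (begin
    numNapkins (path true (suc (m + m))) + 1 ≡⟨ cong (_+ 1) (numNapkins-path true (suc (m + m))) ⟩
    alternations true (m + m) + 1  ≡⟨ cong (_+ 1) (alternations-double true m) ⟩
    m + 1                          ≡⟨ +-comm m 1 ⟩
    suc m                          ≡⟨ cong suc (alternations-double false m) ⟨
    suc (alternations false (m + m)) ∎)
  witness outer = path false (suc (n + n)) , outer-interval , alternations-double true n , (begin
    numNapkins (path false (suc (n + n))) ≡⟨ numNapkins-path false (suc (n + n)) ⟩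
    suc (alternations false (n + n)) ≡⟨ cong suc (alternations-double false n) ⟩
    suc n                            ≡⟨ +-comm 1 n ⟩
    n + 1                            ≡⟨ cong (_+ 1) (alternations-double true n) ⟨
    alternations true (n + n) + 1    ∎)
  witness asym = path true (n + n) , asym-interval , alternations-double true n ,
    trans (numNapkins-path true (n + n)) (trans (alternations-double false n) (sym (alternations-double true n)))

lemma2p1 :
    (∀ G → Interval G → InnerFacing G ⊎ OuterFacing G ⊎ Asymmetric G) ×
    (∀ (n : ℕ) → 0 < n → ∀ (t : IntervalType) →
      (∃ λ G → Interval G × len G ≡ n × HasType t G) ×
      (∀ G H → Interval G → len G ≡ n → HasType t G →
               Interval H → len H ≡ n → HasType t H → SNIso G H))
lemma2p1 = interval-classification , λ where
  zero    ()
  (suc m) _ t → Witnesses.witness m t ,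
                λ G H IG lenG tG IH lenH tH → interval-unique t IG IH (trans lenG (sym lenH)) tG tH
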